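{- Let $G$ be a finite digraph without $2$-cycles such that every edge of $G$ is dominated and every vertex has out-degree $3$. Then for every vertex $v$, the subdigraph induced by the out-neighbors of $v$ contains a directed cycle (through its out-neighbors, i.e. the out-neighbors of $v$ form a cycle).
   Context: Digraphs have no loops and no parallel arcs in the same direction. A $2$-cycle is a pair of arcs $u\to v$, $v\to u$. An edge $u\to v$ is dominated if $u$ and $v$ have a common in-neighbor. -}

module Defs where

open import Data.Nat using (ℕ)
open import Data.Bool using (Bool; true; false; T)
open import Data.Fin using (Fin)
open import Data.List using (List; length; filterᵇ; allFin)
open import Data.Product using (_×_; ∃-syntax)
open import Relation.Binary.PropositionalEquality using (_≡_; _≢_)
open import Relation.Nullary using (¬_)

-- A finite digraph on vertex set Fin n.  Arcs are given by a Boolean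
-- adjacency relation (so there are no parallel arcs in the same direction);
-- loops are excluded.
record Digraph (n : ℕ) : Set where
  field
    arc    : Fin n → Fin n → Bool
    noLoop : ∀ v → arc v v ≡ false
open Digraph public

_⇒[_]_ : ∀ {n} → Fin n → Digraph n → Fin n → Set
u ⇒[ G ] v = T (arc G u v)

No2Cycles : ∀ {n} → Digraph n → Set
No2Cycles G = ∀ u v → u ⇒[ G ] v → ¬ (v ⇒[ G ] u)

Dominated : ∀ {n} → (G : Digraph n) → Fin n → Fin n → Set
Dominated G u v = ∃[ w ] (w ⇒[ G ] u × w ⇒[ G ] v)

EveryArcDominated : ∀ {n} → Digraph n → Set
EveryArcDominated G = ∀ u v → u ⇒[ G ] v → Dominated G u v

outNeighbours : ∀ {n} → Digraph n → Fin n → List (Fin n)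
outNeighbours {n} G v = filterᵇ (arc G v) (allFin n)

outDegree : ∀ {n} → Digraph n → Fin n → ℕ
outDegree G v = length (outNeighbours G v)

{-# OPTIONS --safe #-}
-- Double counting.  Count the triples (w, x, y) with w → x, w → y and x → y.
-- Grouped by w, each out-neighbourhood spans three vertices without 2-cycles,
-- so carries at most 3 arcs: at most 3n triples.  Grouped by the arc x → y,
-- domination gives at least one triple per arc: at least 3n triples.  Hence
-- every out-neighbourhood is a tournament on three vertices and every arc has
-- exactly one dominator.  A transitive out-neighbourhood s → m → t, s → t of v
-- would give the arc m → t the two dominators v and s, so it is a 3-cycle.
module Submission where

open import Defs
open import Data.Nat using (ℕ)
open import Data.Fin using (Fin)
open import Data.Product using (_×_; ∃-syntax)
open import Relation.Binary.PropositionalEquality using (_≡_; _≢_)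

open import Data.Bool using (Bool; true; false; T; if_then_else_; _∨_)
open import Data.Bool.Properties using (T-∨; T-≡)
open import Data.Empty using (⊥-elim)
open import Data.Fin using (zero; suc)
open import Data.List using (List; []; _∷_; length; map; filterᵇ; tabulate; allFin)
open import Data.List.Relation.Unary.All using (All; []; _∷_)
open import Data.List.Relation.Unary.All.Properties using (all-filter)
open import Data.Nat using (zero; suc; _+_; _≤_; z≤n)
open import Data.Nat.ListAction using (sum)
open import Data.Nat.Properties
open import Data.Nat.Tactic.RingSolver using (solve-∀)
open import Data.Product using (_,_)
open import Data.Sum using (_⊎_; inj₁; inj₂)
open import Function using (_∘_; id)
open import Function.Bundles using (Equivalence)
open import Relation.Binary.PropositionalEquality
  using (refl; sym; trans; cong; cong₂; subst; module ≡-Reasoning)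
open import Relation.Nullary using (¬_)
open import Relation.Nullary.Decidable using (T?)

open import Algebra.Properties.CommutativeMonoid.Sum +-0-commutativeMonoid
  using (sum-syntax; sum-cong-≗; sum-replicate-zero; ∑-comm)

when : Bool → ℕ → ℕ
when b x = if b then x else 0

⟦_⟧ : Bool → ℕ
⟦ b ⟧ = when b 1

⟦⟧≤1 : ∀ b → ⟦ b ⟧ ≤ 1
⟦⟧≤1 false = z≤n
⟦⟧≤1 true  = ≤-refl

⟦⟧≤ : ∀ {b m} → (T b → 1 ≤ m) → ⟦ b ⟧ ≤ m
⟦⟧≤ {false} _  = z≤n
⟦⟧≤ {true}  1≤m = 1≤m _

T⇒⟦⟧≡1 : ∀ {b} → T b → ⟦ b ⟧ ≡ 1
T⇒⟦⟧≡1 {true} _ = refl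

⟦⟧-+-disjoint : ∀ p q → ¬ (T p × T q) → ⟦ p ⟧ + ⟦ q ⟧ ≡ ⟦ p ∨ q ⟧
⟦⟧-+-disjoint true  true  ¬both = ⊥-elim (¬both (_ , _))
⟦⟧-+-disjoint true  false _     = refl
⟦⟧-+-disjoint false q     _     = refl

⟦⟧+⟦⟧+⟦⟧≤3 : ∀ p q r → ⟦ p ⟧ + ⟦ q ⟧ + ⟦ r ⟧ ≤ 3
⟦⟧+⟦⟧+⟦⟧≤3 p q r = +-mono-≤ (+-mono-≤ (⟦⟧≤1 p) (⟦⟧≤1 q)) (⟦⟧≤1 r)

⟦⟧-+-+≡3 : ∀ p q r → ⟦ p ⟧ + ⟦ q ⟧ + ⟦ r ⟧ ≡ 3 → T p × T q × T r
⟦⟧-+-+≡3 true  true  true  _  = _ , _ , _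
⟦⟧-+-+≡3 true  true  false ()
⟦⟧-+-+≡3 true  false true  ()
⟦⟧-+-+≡3 true  false false ()
⟦⟧-+-+≡3 false true  true  ()
⟦⟧-+-+≡3 false true  false ()
⟦⟧-+-+≡3 false false true  ()
⟦⟧-+-+≡3 false false false ()

length≡3⇒triple : ∀ {A : Set} (xs : List A) → length xs ≡ 3 →
  ∃[ a ] ∃[ b ] ∃[ c ] (xs ≡ a ∷ b ∷ c ∷ [])
length≡3⇒triple (a ∷ b ∷ c ∷ []) refl = a , b , c , refl

∑-mono-≤ : ∀ {n} {f g : Fin n → ℕ} → (∀ i → f i ≤ g i) → ∑[ i < n ] f i ≤ ∑[ i < n ] g i
∑-mono-≤ {zero}  _   = z≤n
∑-mono-≤ {suc n} f≤g = +-mono-≤ (f≤g zero) (∑-mono-≤ (f≤g ∘ suc))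

∑-≤-antisym : ∀ {n} {f g : Fin n → ℕ} → (∀ i → f i ≤ g i) →
  ∑[ i < n ] g i ≤ ∑[ i < n ] f i → ∀ i → f i ≡ g i
∑-≤-antisym {suc n} {f} {g} f≤g ∑g≤∑f zero =
  ≤-antisym (f≤g zero)
    (+-cancelʳ-≤ _ _ _ (≤-trans ∑g≤∑f (+-monoʳ-≤ (f zero) (∑-mono-≤ (f≤g ∘ suc)))))
∑-≤-antisym {suc n} {f} {g} f≤g ∑g≤∑f (suc i) =
  ∑-≤-antisym (f≤g ∘ suc)
    (+-cancelˡ-≤ (g zero) _ _ (≤-trans ∑g≤∑f (+-monoˡ-≤ _ (f≤g zero)))) i

term≤∑ : ∀ {n} (f : Fin n → ℕ) i → f i ≤ ∑[ j < n ] f j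
term≤∑ f zero    = m≤m+n (f zero) _
term≤∑ f (suc i) = ≤-trans (term≤∑ (f ∘ suc) i) (m≤n+m _ (f zero))

two-terms≤∑ : ∀ {n} (f : Fin n → ℕ) i j → i ≢ j → f i + f j ≤ ∑[ k < n ] f k
two-terms≤∑ f zero    zero    i≢j = ⊥-elim (i≢j refl)
two-terms≤∑ f zero    (suc j) _   = +-monoʳ-≤ (f zero) (term≤∑ (f ∘ suc) j)
two-terms≤∑ f (suc i) zero    _   =
  ≤-trans (≤-reflexive (+-comm (f (suc i)) (f zero))) (+-monoʳ-≤ (f zero) (term≤∑ (f ∘ suc) i))
two-terms≤∑ f (suc i) (suc j) i≢j =
  ≤-trans (two-terms≤∑ (f ∘ suc) i j (i≢j ∘ cong suc)) (m≤n+m _ (f zero))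

∑-when : ∀ {n} b (f : Fin n → ℕ) → ∑[ i < n ] when b (f i) ≡ when b (∑[ i < n ] f i)
∑-when {n} false f = sum-replicate-zero n
∑-when     true  f = refl

∑-when≡sum-filterᵇ : ∀ {A : Set} {n} (p : A → Bool) (h : A → ℕ) (f : Fin n → A) →
  ∑[ i < n ] when (p (f i)) (h (f i)) ≡ sum (map h (filterᵇ p (tabulate f)))
∑-when≡sum-filterᵇ {n = zero}  p h f = refl
∑-when≡sum-filterᵇ {n = suc n} p h f with p (f zero)
... | true  = cong (h (f zero) +_) (∑-when≡sum-filterᵇ p h (f ∘ suc))
... | false = ∑-when≡sum-filterᵇ p h (f ∘ suc)

length-filterᵇ : ∀ {A : Set} {n} (p : A → Bool) (f : Fin n → A) →
  length (filterᵇ p (tabulate f)) ≡ ∑[ i < n ] ⟦ p (f i) ⟧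
length-filterᵇ {n = zero}  p f = refl
length-filterᵇ {n = suc n} p f with p (f zero)
... | true  = cong suc (length-filterᵇ p (f ∘ suc))
... | false = length-filterᵇ p (f ∘ suc)

module _ {n} (G : Digraph n) where

  ⇒-irrefl : ∀ {u v} → u ⇒[ G ] v → u ≢ v
  ⇒-irrefl {u} u⇒u refl = subst T (noLoop G u) u⇒u

  adjacent : Fin n → Fin n → Bool
  adjacent x y = arc G x y ∨ arc G y x

  Cyclic : Fin n → Fin n → Fin n → Set
  Cyclic a b c = a ⇒[ G ] b × b ⇒[ G ] c × c ⇒[ G ] a

  Transitive : Fin n → Fin n → Fin n → Set
  Transitive s m t = s ⇒[ G ] m × s ⇒[ G ] t × m ⇒[ G ] t

  cyclic-unless-transitive : (P : Fin n → Set) →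
    (∀ {s m t} → P s → P m → P t → ¬ Transitive s m t) → ∀ {a b c} → P a → P b → P c →
    T (adjacent a b) → T (adjacent b c) → T (adjacent c a) → Cyclic a b c ⊎ Cyclic a c b
  cyclic-unless-transitive P ¬tr pa pb pc ab bc ca
    with Equivalence.to T-∨ ab | Equivalence.to T-∨ bc | Equivalence.to T-∨ ca
  ... | inj₁ a⇒b | inj₁ b⇒c | inj₁ c⇒a = inj₁ (a⇒b , b⇒c , c⇒a)
  ... | inj₂ b⇒a | inj₂ c⇒b | inj₂ a⇒c = inj₂ (a⇒c , c⇒b , b⇒a)
  ... | inj₁ a⇒b | inj₁ b⇒c | inj₂ a⇒c = ⊥-elim (¬tr pa pb pc (a⇒b , a⇒c , b⇒c))
  ... | inj₁ a⇒b | inj₂ c⇒b | inj₁ c⇒a = ⊥-elim (¬tr pc pa pb (c⇒a , c⇒b , a⇒b))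
  ... | inj₁ a⇒b | inj₂ c⇒b | inj₂ a⇒c = ⊥-elim (¬tr pa pc pb (a⇒c , a⇒b , c⇒b))
  ... | inj₂ b⇒a | inj₁ b⇒c | inj₁ c⇒a = ⊥-elim (¬tr pb pc pa (b⇒c , b⇒a , c⇒a))
  ... | inj₂ b⇒a | inj₁ b⇒c | inj₂ a⇒c = ⊥-elim (¬tr pb pa pc (b⇒a , b⇒c , a⇒c))
  ... | inj₂ b⇒a | inj₂ c⇒b | inj₁ c⇒a = ⊥-elim (¬tr pc pb pa (c⇒b , c⇒a , b⇒a))

  outDegree≡∑ : ∀ v → outDegree G v ≡ ∑[ y < n ] ⟦ arc G v y ⟧
  outDegree≡∑ v = length-filterᵇ (arc G v) id

  domination : Fin n → Fin n → Fin n → ℕ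
  domination w x y = when (arc G w x) (when (arc G w y) ⟦ arc G x y ⟧)

  dominatorCount : Fin n → Fin n → ℕ
  dominatorCount x y = ∑[ w < n ] domination w x y

  arcsAmongOut : Fin n → ℕ
  arcsAmongOut w = ∑[ x < n ] ∑[ y < n ] domination w x y

  arcsAmong : List (Fin n) → ℕ
  arcsAmong xs = sum (map (λ x → sum (map (λ y → ⟦ arc G x y ⟧) xs)) xs)

  domination≡1 : ∀ {w x y} → w ⇒[ G ] x → w ⇒[ G ] y → x ⇒[ G ] y → domination w x y ≡ 1
  domination≡1 w⇒x w⇒y x⇒y
    rewrite Equivalence.to T-≡ w⇒x | Equivalence.to T-≡ w⇒y | Equivalence.to T-≡ x⇒y = refl

  ∑arcsAmongOut≡∑dominatorCount :
    ∑[ w < n ] arcsAmongOut w ≡ ∑[ x < n ] ∑[ y < n ] dominatorCount x y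
  ∑arcsAmongOut≡∑dominatorCount = begin
    ∑[ w < n ] ∑[ x < n ] ∑[ y < n ] domination w x y
      ≡⟨ ∑-comm (λ w x → ∑[ y < n ] domination w x y) ⟩
    ∑[ x < n ] ∑[ w < n ] ∑[ y < n ] domination w x y
      ≡⟨ sum-cong-≗ (λ x → ∑-comm (λ w y → domination w x y)) ⟩
    ∑[ x < n ] ∑[ y < n ] ∑[ w < n ] domination w x y  ∎
    where open ≡-Reasoning

  arcsAmongOut≡arcsAmong : ∀ w → arcsAmongOut w ≡ arcsAmong (outNeighbours G w)
  arcsAmongOut≡arcsAmong w = begin
    ∑[ x < n ] ∑[ y < n ] when (arc G w x) (when (arc G w y) ⟦ arc G x y ⟧)
      ≡⟨ sum-cong-≗ (λ x → ∑-when (arc G w x) (λ y → when (arc G w y) ⟦ arc G x y ⟧)) ⟩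
    ∑[ x < n ] when (arc G w x) (∑[ y < n ] when (arc G w y) ⟦ arc G x y ⟧)
      ≡⟨ sum-cong-≗ (λ x → cong (when (arc G w x))
                               (∑-when≡sum-filterᵇ (arc G w) (λ y → ⟦ arc G x y ⟧) id)) ⟩
    ∑[ x < n ] when (arc G w x) (sum (map (λ y → ⟦ arc G x y ⟧) (outNeighbours G w)))
      ≡⟨ ∑-when≡sum-filterᵇ (arc G w) _ id ⟩
    arcsAmong (outNeighbours G w)  ∎
    where open ≡-Reasoning

  arcsAmong-triple : ∀ a b c → arcsAmong (a ∷ b ∷ c ∷ []) ≡
      (⟦ arc G a b ⟧ + ⟦ arc G b a ⟧) + (⟦ arc G b c ⟧ + ⟦ arc G c b ⟧)
    + (⟦ arc G c a ⟧ + ⟦ arc G a c ⟧)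
  arcsAmong-triple a b c rewrite noLoop G a | noLoop G b | noLoop G c =
    regroup ⟦ arc G a b ⟧ ⟦ arc G a c ⟧ ⟦ arc G b a ⟧ ⟦ arc G b c ⟧ ⟦ arc G c a ⟧ ⟦ arc G c b ⟧
    where
    -- the left side is the normal form of arcsAmong (a ∷ b ∷ c ∷ []) once its loops are 0
    regroup : ∀ ab ac ba bc ca cb →
      ab + (ac + 0) + (ba + (bc + 0) + (ca + (cb + 0) + 0)) ≡ (ab + ba) + (bc + cb) + (ca + ac)
    regroup = solve-∀

  arcsAmongOut≡adjacencies : No2Cycles G → ∀ {w a b c} → outNeighbours G w ≡ a ∷ b ∷ c ∷ [] →
    arcsAmongOut w ≡ ⟦ adjacent a b ⟧ + ⟦ adjacent b c ⟧ + ⟦ adjacent c a ⟧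
  arcsAmongOut≡adjacencies no2 {w} {a} {b} {c} out≡abc = begin
    arcsAmongOut w                ≡⟨ arcsAmongOut≡arcsAmong w ⟩
    arcsAmong (outNeighbours G w) ≡⟨ cong arcsAmong out≡abc ⟩
    arcsAmong (a ∷ b ∷ c ∷ [])     ≡⟨ arcsAmong-triple a b c ⟩
    _                             ≡⟨ cong₂ _+_ (cong₂ _+_ (pair a b) (pair b c)) (pair c a) ⟩
    ⟦ adjacent a b ⟧ + ⟦ adjacent b c ⟧ + ⟦ adjacent c a ⟧  ∎
    where
    open ≡-Reasoning
    pair : ∀ x y → ⟦ arc G x y ⟧ + ⟦ arc G y x ⟧ ≡ ⟦ adjacent x y ⟧
    pair x y = ⟦⟧-+-disjoint (arc G x y) (arc G y x) λ (x⇒y , y⇒x) → no2 x y x⇒y y⇒x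

  arc≤dominatorCount : EveryArcDominated G → ∀ x y → ⟦ arc G x y ⟧ ≤ dominatorCount x y
  arc≤dominatorCount dom x y = ⟦⟧≤ λ x⇒y →
    let w , w⇒x , w⇒y = dom x y x⇒y
    in subst (_≤ dominatorCount x y) (domination≡1 w⇒x w⇒y x⇒y) (term≤∑ (λ w → domination w x y) w)

module _ {n} (G : Digraph n) (no2 : No2Cycles G) (dom : EveryArcDominated G)
         (deg : ∀ v → outDegree G v ≡ 3) where

  outNeighbours≡triple : ∀ v → ∃[ a ] ∃[ b ] ∃[ c ] (outNeighbours G v ≡ a ∷ b ∷ c ∷ [])
  outNeighbours≡triple v = length≡3⇒triple (outNeighbours G v) (deg v)

  arcsAmongOut≤3 : ∀ w → arcsAmongOut G w ≤ 3
  arcsAmongOut≤3 w with outNeighbours≡triple w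
  ... | a , b , c , out≡abc = subst (_≤ 3) (sym (arcsAmongOut≡adjacencies G no2 out≡abc))
                                    (⟦⟧+⟦⟧+⟦⟧≤3 (adjacent G a b) (adjacent G b c) (adjacent G c a))

  ∑arcs≡∑3 : ∑[ x < n ] ∑[ y < n ] ⟦ arc G x y ⟧ ≡ ∑[ x < n ] 3
  ∑arcs≡∑3 = sum-cong-≗ λ x → trans (sym (outDegree≡∑ G x)) (deg x)

  ∑3≤∑arcsAmongOut : ∑[ w < n ] 3 ≤ ∑[ w < n ] arcsAmongOut G w
  ∑3≤∑arcsAmongOut = begin
    ∑[ x < n ] 3                                ≡⟨ sym ∑arcs≡∑3 ⟩
    ∑[ x < n ] ∑[ y < n ] ⟦ arc G x y ⟧         ≤⟨ ∑-mono-≤ (∑-mono-≤ ∘ arc≤dominatorCount G dom) ⟩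
    ∑[ x < n ] ∑[ y < n ] dominatorCount G x y  ≡⟨ sym (∑arcsAmongOut≡∑dominatorCount G) ⟩
    ∑[ w < n ] arcsAmongOut G w                 ∎
    where open ≤-Reasoning

  arcsAmongOut≡3 : ∀ w → arcsAmongOut G w ≡ 3
  arcsAmongOut≡3 = ∑-≤-antisym arcsAmongOut≤3 ∑3≤∑arcsAmongOut

  uniquelyDominated : ∀ x y → ⟦ arc G x y ⟧ ≡ dominatorCount G x y
  uniquelyDominated x = ∑-≤-antisym (arc≤dominatorCount G dom x) (≤-reflexive (sym (rowSums x)))
    where
    ∑dominatorCount≤∑arcs :
      ∑[ x < n ] ∑[ y < n ] dominatorCount G x y ≤ ∑[ x < n ] ∑[ y < n ] ⟦ arc G x y ⟧
    ∑dominatorCount≤∑arcs = begin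
      ∑[ x < n ] ∑[ y < n ] dominatorCount G x y  ≡⟨ sym (∑arcsAmongOut≡∑dominatorCount G) ⟩
      ∑[ w < n ] arcsAmongOut G w                 ≤⟨ ∑-mono-≤ arcsAmongOut≤3 ⟩
      ∑[ x < n ] 3                                ≡⟨ sym ∑arcs≡∑3 ⟩
      ∑[ x < n ] ∑[ y < n ] ⟦ arc G x y ⟧         ∎
      where open ≤-Reasoning
    rowSums : ∀ x → ∑[ y < n ] ⟦ arc G x y ⟧ ≡ ∑[ y < n ] dominatorCount G x y
    rowSums = ∑-≤-antisym (∑-mono-≤ ∘ arc≤dominatorCount G dom) ∑dominatorCount≤∑arcs

  pairwiseAdjacentOut : ∀ {v a b c} → outNeighbours G v ≡ a ∷ b ∷ c ∷ [] →
    T (adjacent G a b) × T (adjacent G b c) × T (adjacent G c a)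
  pairwiseAdjacentOut {v} {a} {b} {c} out≡abc = ⟦⟧-+-+≡3 (adjacent G a b) (adjacent G b c) (adjacent G c a)
    (trans (sym (arcsAmongOut≡adjacencies G no2 out≡abc)) (arcsAmongOut≡3 v))

  noTransitiveOut : ∀ {v s m t} → v ⇒[ G ] s → v ⇒[ G ] m → v ⇒[ G ] t → ¬ Transitive G s m t
  noTransitiveOut {v} {s} {m} {t} v⇒s v⇒m v⇒t (s⇒m , s⇒t , m⇒t) = <-irrefl refl (begin-strict
    1                                        <⟨ n<1+n 1 ⟩
    2                                        ≡⟨ cong₂ _+_ (domination≡1 G v⇒m v⇒t m⇒t)
                                                          (domination≡1 G s⇒m s⇒t m⇒t) ⟨
    domination G v m t + domination G s m t  ≤⟨ two-terms≤∑ (λ w → domination G w m t) v s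
                                                             (⇒-irrefl G v⇒s) ⟩
    dominatorCount G m t                     ≡⟨ uniquelyDominated m t ⟨
    ⟦ arc G m t ⟧                            ≡⟨ T⇒⟦⟧≡1 m⇒t ⟩
    1                                        ∎)
    where open ≤-Reasoning

OutCycle : ∀ {n} → Digraph n → Fin n → Set
OutCycle G v = ∃[ a ] ∃[ b ] ∃[ c ]
  (a ≢ b × b ≢ c × a ≢ c × v ⇒[ G ] a × v ⇒[ G ] b × v ⇒[ G ] c × Cyclic G a b c)

cyclic⇒OutCycle : ∀ {n} (G : Digraph n) {v a b c} → v ⇒[ G ] a → v ⇒[ G ] b → v ⇒[ G ] c →
  Cyclic G a b c → OutCycle G v
cyclic⇒OutCycle G v⇒a v⇒b v⇒c (a⇒b , b⇒c , c⇒a) =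
  _ , _ , _ , ⇒-irrefl G a⇒b , ⇒-irrefl G b⇒c , ⇒-irrefl G c⇒a ∘ sym ,
  v⇒a , v⇒b , v⇒c , a⇒b , b⇒c , c⇒a

corollary3p3 : ∀ {n} (G : Digraph n) → No2Cycles G → EveryArcDominated G →
    (∀ v → outDegree G v ≡ 3) →
    ∀ v → ∃[ a ] ∃[ b ] ∃[ c ]
      (a ≢ b × b ≢ c × a ≢ c ×
       v ⇒[ G ] a × v ⇒[ G ] b × v ⇒[ G ] c ×
       a ⇒[ G ] b × b ⇒[ G ] c × c ⇒[ G ] a)
corollary3p3 {n} G no2 dom deg v with outNeighbours≡triple G no2 dom deg v
... | a , b , c , out≡abc
  with subst (All (v ⇒[ G ]_)) out≡abc (all-filter (T? ∘ arc G v) (allFin n))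
... | v⇒a ∷ v⇒b ∷ v⇒c ∷ []
  with pairwiseAdjacentOut G no2 dom deg out≡abc
... | ab , bc , ca
  with cyclic-unless-transitive G (v ⇒[ G ]_) (noTransitiveOut G no2 dom deg) v⇒a v⇒b v⇒c ab bc ca
... | inj₁ abc = cyclic⇒OutCycle G v⇒a v⇒b v⇒c abc
... | inj₂ acb = cyclic⇒OutCycle G v⇒a v⇒c v⇒b acb
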